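{- Let $G$ be a connected graph of order $n\ge 4$ such that its complement $\overline{G}$ is connected. Then $$2|\mathrm{leaf}(G)|+2|\mathrm{leaf}(\overline{G})|\le \gamma_{tc}(M(G))+\gamma_{tc}(M(\overline{G}))\le \frac{n^2+3n-4}{2}.$$
   Context: All graphs are finite, simple and undirected; $\overline{G}$ is the complement of $G$, and $\mathrm{leaf}(H)=\{v\in V(H)\mid \deg_H(v)=1\}$. For a graph $H$, a set $D\subseteq V(H)$ is a total dominating set if every vertex of $H$ has a neighbor in $D$. A set $D\subseteq V(H)$ is a total outer-connected dominating set of $H$ if $D$ is a total dominating set and the induced subgraph $H[V(H)\setminus D]$ is connected; $\gamma_{tc}(H)$ denotes the minimum cardinality of a total outer-connected dominating set of $H$. The middle graph $M(G)$ of a graph $G$ has vertex set $V(G)\cup E(G)$, where two elements $x,y$ are adjacent iff either $x,y\in E(G)$ are edges of $G$ sharing an endpoint, or one of them is a vertex of $G$ and the other is an edge of $G$ incident to it. -}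

module Defs where

open import Data.Nat using (ℕ; _≡ᵇ_; _<_)
open import Data.Fin using (Fin; toℕ)
open import Data.Fin.Properties using (_≟_)
open import Data.Bool using (Bool; true; false; not; _∧_; T)
open import Data.List using (List; length; filter; allFin)
open import Data.List.Membership.Propositional using (_∈_; _∉_)
open import Data.List.Relation.Unary.All using (All)
open import Data.List.Relation.Unary.Unique.Propositional using (Unique)
open import Data.Product using (Σ; _×_; ∃; ∃-syntax)
open import Data.Sum using (_⊎_)
open import Data.Unit using (⊤)
open import Relation.Nullary using (¬_; does)
open import Relation.Nullary.Decidable using (⌊_⌋)
open import Relation.Binary.PropositionalEquality using (_≡_)

record Graph (n : ℕ) : Set where
  field
    adj    : Fin n → Fin n → Bool
    adj-sym    : ∀ i j → adj i j ≡ adj j i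
    adj-irrefl : ∀ i → adj i i ≡ false
open Graph public

compl : ∀ {n} → Graph n → Graph n
compl {n} G = record
  { adj = λ i j → not (adj G i j) ∧ not ⌊ i ≟ j ⌋
  ; adj-sym = symc
  ; adj-irrefl = irc }
  where
  open import Relation.Binary.PropositionalEquality using (refl; sym; cong₂; cong)
  open import Relation.Nullary using (yes; no)
  symc : ∀ i j → (not (adj G i j) ∧ not ⌊ i ≟ j ⌋) ≡ (not (adj G j i) ∧ not ⌊ j ≟ i ⌋)
  symc i j with i ≟ j | j ≟ i
  ... | yes _ | yes _ = cong₂ _∧_ (cong not (Graph.adj-sym G i j)) refl
  ... | no _ | no _ = cong₂ _∧_ (cong not (Graph.adj-sym G i j)) refl
  ... | yes p | no q = Data.Empty.⊥-elim (q (sym p)) where import Data.Empty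
  ... | no p | yes q = Data.Empty.⊥-elim (p (sym q)) where import Data.Empty
  irc : ∀ i → (not (adj G i i) ∧ not ⌊ i ≟ i ⌋) ≡ false
  irc i with i ≟ i
  ... | yes _ = Data.Bool.Properties.∧-zeroʳ _ where import Data.Bool.Properties
  ... | no ¬p = Data.Empty.⊥-elim (¬p refl) where import Data.Empty

deg : ∀ {n} → Graph n → Fin n → ℕ
deg G i = length (filter (λ j → T? (adj G i j)) (allFin _))
  where open import Data.Bool.Properties using () renaming (T? to T?)

leaf : ∀ {n} → Graph n → List (Fin n)
leaf G = filter (λ i → deg G i Data.Nat.≟ 1) (allFin _)
  where import Data.Nat

record Gr (C : Set) : Set₁ where
  field
    InV : C → Set
    Adj : C → C → Set
open Gr public

data Walk {C : Set} (H : Gr C) (P : C → Set) : C → C → Set where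
  here : ∀ {u} → P u → Walk H P u u
  step : ∀ {u w v} → P u → Adj H u w → Walk H P w v → Walk H P u v

-- H[V(H) \ D] is connected: any two vertices outside D are joined by
-- a walk using only vertices of V(H) \ D
OuterConnected : ∀ {C} → Gr C → List C → Set
OuterConnected {C} H D =
  ∀ u v → InV H u → u ∉ D → InV H v → v ∉ D →
    Walk H (λ x → InV H x × x ∉ D) u v

TotalDominating : ∀ {C} → Gr C → List C → Set
TotalDominating H D =
  Unique D × All (InV H) D ×
  (∀ v → InV H v → ∃[ u ] (u ∈ D × Adj H v u))

TOCDS : ∀ {C} → Gr C → List C → Set
TOCDS H D = TotalDominating H D × OuterConnected H D

γtc : ∀ {C} → Gr C → ℕ → Set
γtc H k = (∃[ D ] (TOCDS H D × length D ≡ k)) ×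
          (∀ D → TOCDS H D → k Data.Nat.≤ length D)
  where import Data.Nat

asGr : ∀ {n} → Graph n → Gr (Fin n)
asGr G = record { InV = λ _ → ⊤ ; Adj = λ i j → T (adj G i j) }

Connected : ∀ {n} → Graph n → Set
Connected {n} G = ∀ (u v : Fin n) → Walk (asGr G) (λ _ → ⊤) u v

-- Middle graph M(G): vertices V(G) ∪ E(G); an edge {i,j} of G is
-- represented by  edg i j  with  i < j  and  ij ∈ E(G).

data MV (n : ℕ) : Set where
  vtx : Fin n → MV n
  edg : Fin n → Fin n → MV n

IsEdge : ∀ {n} → Graph n → Fin n → Fin n → Set
IsEdge G i j = (toℕ i < toℕ j) × T (adj G i j)

MInV : ∀ {n} → Graph n → MV n → Set
MInV G (vtx a)   = ⊤
MInV G (edg i j) = IsEdge G i j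

MAdj : ∀ {n} → Graph n → MV n → MV n → Set
MAdj G (vtx a)   (vtx b)   = Data.Empty.⊥ where import Data.Empty
MAdj G (vtx a)   (edg i j) = IsEdge G i j × (a ≡ i ⊎ a ≡ j)
MAdj G (edg i j) (vtx a)   = IsEdge G i j × (a ≡ i ⊎ a ≡ j)
MAdj G (edg i j) (edg k l) =
  IsEdge G i j × IsEdge G k l × ¬ (edg {_} i j ≡ edg k l) ×
  (i ≡ k ⊎ i ≡ l ⊎ j ≡ k ⊎ j ≡ l)

Middle : ∀ {n} → Graph n → Gr (MV n)
Middle G = record { InV = MInV G ; Adj = MAdj G }

{-# OPTIONS --safe #-}
module Submission where

-- Upper bound: all vertices of M(G) except one vertex of G form a total
-- outer-connected dominating set (what remains is a single vertex), of size
-- (n − 1) + |E(G)|. Since E(G) and E(Ḡ) split the n(n − 1)/2 pairs of vertices,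
-- the two sets together have (n² + 3n − 4)/2 elements.
-- Lower bound: the vertex v of a leaf has the pendant edge e_v as its only
-- neighbour in M(G), so e_v lies in every total dominating set D, and these
-- edges are distinct because leaves of a connected graph on ≥ 3 vertices are
-- non-adjacent. If moreover some leaf v is missing from D, then v is isolated
-- in M(G) − D, which forces every other vertex of G into D. Either way
-- |D| ≥ 2|leaf(G)|.
-- The minimum γtc exists since being a total outer-connected dominating set
-- is decidable for lists over the finite vertex set of M(G).

open import Defs
open import Data.Nat using (ℕ; zero; suc; _+_; _*_; _∸_; _≤_; _<_; _<?_; z≤n; s≤s)
open import Data.Nat.Properties
  using (≤-refl; ≤-trans; ≤-pred; <-≤-trans; +-mono-≤; +-monoʳ-≤; *-monoʳ-≤; +-suc; +-identityʳ;
         <-asym; ≤∧≢⇒<; ≮⇒≥; n≮0; n≤1+n; m+n∸n≡m; module ≤-Reasoning)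
open import Data.Nat.Tactic.RingSolver using (solve-∀)
import Data.List.Extrema.Nat as Extrema
open import Data.Fin using (Fin; toℕ; punchIn) renaming (zero to fzero; suc to fsuc)
open import Data.Fin.Properties using (toℕ-injective; punchInᵢ≢i) renaming (_≟_ to _≟ᶠ_)
open import Data.Bool using (true; T)
open import Data.Bool.Properties using (T?)
open import Data.List using (List; []; _∷_; [_]; length; filter; map; _++_; concatMap; tabulate; allFin)
open import Data.List.Properties using (filter-notAll; length-++; length-map; length-tabulate)
open import Data.List.Membership.Propositional using (_∈_; _∉_; find; lose)
open import Data.List.Membership.Propositional.Properties
  using (∈-filter⁺; ∈-filter⁻; ∈-map⁺; ∈-map⁻; ∈-++⁺ˡ; ∈-++⁺ʳ; ∈-++⁻; ∈-allFin; ∈-tabulate⁺; ∈-tabulate⁻; ∈-concatMap⁺; ∈-length)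
open import Data.List.Relation.Unary.Any using (here; there; any?)
import Data.List.Relation.Unary.Any as Any
open import Data.List.Relation.Unary.All as All using (All; []; _∷_; all?)
open import Data.List.Relation.Unary.All.Properties using (all-filter; ¬All⇒Any¬) renaming (map⁺ to All-map⁺; ++⁺ to All-++⁺)
open import Data.List.Relation.Unary.Unique.Propositional using (Unique)
open import Data.List.Relation.Unary.AllPairs using ([]; _∷_)
import Data.List.Relation.Unary.Unique.Propositional.Properties as Unique
open import Data.List.Relation.Unary.Unique.DecPropositional using (unique?)
open import Data.Product using (_×_; _,_; proj₁; proj₂; ∃-syntax; uncurry)
open import Data.Sum using (_⊎_; inj₁; inj₂)
open import Data.Unit using (⊤; tt)
open import Data.Empty using (⊥; ⊥-elim)
open import Relation.Nullary using (¬_; Dec; yes; no)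
open import Relation.Nullary.Decidable using (_×-dec_; _⊎-dec_; _→-dec_; ¬?)
open import Relation.Unary using (Decidable)
open import Relation.Binary.Definitions using (DecidableEquality)
open import Relation.Binary.PropositionalEquality using (_≡_; _≢_; refl; sym; trans; cong; cong₂; subst; module ≡-Reasoning)
open import Function using (_∘_; case_of_)

module _ {A : Set} where

  Unique-map⁺ : ∀ {B : Set} {f : A → B} {xs} → Unique xs →
                (∀ {x y} → x ∈ xs → y ∈ xs → f x ≡ f y → x ≡ y) → Unique (map f xs)
  Unique-map⁺ [] _ = []
  Unique-map⁺ (x∉xs ∷ xs!) inj =
    All-map⁺ (All.tabulate λ y∈xs fx≡fy → All.lookup x∉xs y∈xs (inj (here refl) (there y∈xs) fx≡fy))
    ∷ Unique-map⁺ xs! (λ x∈ y∈ → inj (there x∈) (there y∈))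

  length-filter-disjoint : ∀ {P Q : A → Set} (P? : Decidable P) (Q? : Decidable Q) →
                           (∀ x → P x → Q x → ⊥) →
                           ∀ xs → length (filter P? xs) + length (filter Q? xs) ≤ length xs
  length-filter-disjoint P? Q? disjoint [] = z≤n
  length-filter-disjoint P? Q? disjoint (x ∷ xs) with ih ← length-filter-disjoint P? Q? disjoint xs | P? x | Q? x
  ... | yes px | yes qx = ⊥-elim (disjoint x px qx)
  ... | yes _  | no _   = s≤s ih
  ... | no _   | yes _  = subst (_≤ suc (length xs)) (sym (+-suc _ _)) (s≤s ih)
  ... | no _   | no _   = ≤-trans ih (n≤1+n _)

  boundedLists : ℕ → List A → List (List A)
  boundedLists zero    xs = [ [] ]
  boundedLists (suc k) xs = [] ∷ concatMap (λ x → map (x ∷_) (boundedLists k xs)) xs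

  ∈-boundedLists : ∀ {k xs ys} → All (_∈ xs) ys → length ys ≤ k → ys ∈ boundedLists k xs
  ∈-boundedLists {zero}  []         _          = here refl
  ∈-boundedLists {suc k} []         _          = here refl
  ∈-boundedLists {suc k} (y∈xs ∷ ys⊆xs) (s≤s ≤k) =
    there (∈-concatMap⁺ _ (Any.map (λ { refl → ∈-map⁺ _ (∈-boundedLists ys⊆xs ≤k) }) y∈xs))

  module _ (_≟_ : DecidableEquality A) where

    Unique⇒length≤ : ∀ {xs} ys → Unique xs → (∀ {x} → x ∈ xs → x ∈ ys) → length xs ≤ length ys
    Unique⇒length≤ ys [] _ = z≤n
    Unique⇒length≤ {x ∷ xs} ys (x∉xs ∷ xs!) xs⊆ys =
      ≤-trans (s≤s (Unique⇒length≤ (filter ≢x? ys) xs! xs⊆ys∖x))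
              (filter-notAll ≢x? ys (Any.map (λ { refl x≢x → x≢x refl }) (xs⊆ys (here refl))))
      where
      ≢x? : Decidable (_≢ x)
      ≢x? y = ¬? (y ≟ x)
      xs⊆ys∖x : ∀ {y} → y ∈ xs → y ∈ filter ≢x? ys
      xs⊆ys∖x y∈xs = ∈-filter⁺ ≢x? (xs⊆ys (there y∈xs)) (λ y≡x → All.lookup x∉xs y∈xs (sym y≡x))

module _ {C : Set} {H : Gr C} where

  Walk-map : ∀ {P Q : C → Set} → (∀ {x} → P x → Q x) → ∀ {u v} → Walk H P u v → Walk H Q u v
  Walk-map f (here pu)       = here (f pu)
  Walk-map f (step pu uw wv) = step (f pu) uw (Walk-map f wv)

  Walk-head : ∀ {P u v} → Walk H P u v → P u
  Walk-head (here pu)     = pu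
  Walk-head (step pu _ _) = pu

  module _ (_≟_ : DecidableEquality C) where

    -- Cut the walk after its last visit to u.
    Walk-avoid : ∀ {P a v} u → u ≢ v → Walk H P a v →
                 Walk H (λ x → P x × x ≢ u) a v ⊎ ∃[ w ] (Adj H u w × Walk H (λ x → P x × x ≢ u) w v)
    Walk-avoid u u≢v (here pv) = inj₁ (here (pv , λ v≡u → u≢v (sym v≡u)))
    Walk-avoid u u≢v (step {a} {w} pa aw wv) with Walk-avoid u u≢v wv
    ... | inj₂ later = inj₂ later
    ... | inj₁ wv⁻ with a ≟ u
    ...   | yes refl = inj₂ (w , aw , wv⁻)
    ...   | no a≢u   = inj₁ (step (pa , a≢u) aw wv⁻)

module FiniteSearch {C : Set} (_≟_ : DecidableEquality C) (H : Gr C)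
  (InV? : Decidable (InV H)) (Adj? : ∀ x y → Dec (Adj H x y))
  (vs : List C) (vs-complete : ∀ {x} → InV H x → x ∈ vs) where

  open import Data.List.Membership.DecPropositional _≟_ using (_∈?_)

  private
    _∖_ : List C → C → List C
    L ∖ u = filter (λ x → ¬? (x ≟ u)) L

    ∈-∖⁻ : ∀ {L u x} → x ∈ L ∖ u → x ∈ L
    ∈-∖⁻ {L} x∈ = proj₁ (∈-filter⁻ (λ x → ¬? (x ≟ _)) {xs = L} x∈)

    length-∖ : ∀ {L u} → u ∈ L → length (L ∖ u) < length L
    length-∖ {L} {u} u∈L = filter-notAll (λ x → ¬? (x ≟ u)) L (Any.map (λ { refl u≢u → u≢u refl }) u∈L)

    ∈-∖⁺ : ∀ {L u x} → x ∈ L → x ≢ u → x ∈ L ∖ u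
    ∈-∖⁺ {u = u} = ∈-filter⁺ (λ x → ¬? (x ≟ u))

    first-step : ∀ {L u v} → u ≢ v → Walk H (_∈ L) u v →
                 Any.Any (λ w → Adj H u w × Walk H (_∈ L ∖ u) w v) L
    first-step u≢v (here _) = ⊥-elim (u≢v refl)
    first-step {L} {u} u≢v (step _ uw wv) with Walk-avoid _≟_ u u≢v wv
    ... | inj₁ wv⁻             = lose (proj₁ (Walk-head wv⁻)) (uw , Walk-map (λ p → ∈-∖⁺ (proj₁ p) (proj₂ p)) wv⁻)
    ... | inj₂ (w , uw₁ , wv⁻) = lose (proj₁ (Walk-head wv⁻)) (uw₁ , Walk-map (λ p → ∈-∖⁺ (proj₁ p) (proj₂ p)) wv⁻)

  -- A walk never needs to return to its start, so each step may delete the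
  -- current vertex from the allowed list L.
  walkWithin? : ∀ k (L : List C) → length L ≤ k → ∀ u v → Dec (Walk H (_∈ L) u v)
  walkWithin? k L L≤k u v with u ∈? L | u ≟ v
  ... | no u∉L  | _        = no (λ uv → u∉L (Walk-head uv))
  ... | yes u∈L | yes refl = yes (here u∈L)
  walkWithin? zero L L≤0 u v | yes u∈L | no _ = ⊥-elim (n≮0 (<-≤-trans (∈-length u∈L) L≤0))
  walkWithin? (suc k) L L≤k u v | yes u∈L | no u≢v
    with any? (λ w → Adj? u w ×-dec walkWithin? k (L ∖ u) (≤-pred (<-≤-trans (length-∖ u∈L) L≤k)) w v) L
  ... | yes steps = yes (let (w , _ , uw , wv) = find steps in step u∈L uw (Walk-map ∈-∖⁻ wv))
  ... | no ¬steps = no (λ uv → ¬steps (first-step u≢v uv))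

  walk? : ∀ {P : C → Set} → Decidable P → (∀ {x} → P x → x ∈ vs) → ∀ u v → Dec (Walk H P u v)
  walk? {P} P? P⊆vs u v with walkWithin? _ (filter P? vs) ≤-refl u v
  ... | yes uv = yes (Walk-map (λ x∈ → proj₂ (∈-filter⁻ P? {xs = vs} x∈)) uv)
  ... | no ¬uv = no (λ uv → ¬uv (Walk-map (λ px → ∈-filter⁺ P? (P⊆vs px) px) uv))

  dominates? : ∀ D → Dec (∀ v → InV H v → ∃[ u ] (u ∈ D × Adj H v u))
  dominates? D with all? (λ v → InV? v →-dec any? (Adj? v) D) vs
  ... | yes all = yes (λ v iv → find (All.lookup all (vs-complete iv) iv))
  ... | no ¬all = no (λ dom → ¬all (All.tabulate (λ {v} _ iv → let (u , u∈D , vu) = dom v iv in lose u∈D vu)))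

  outerConnected? : ∀ D → Dec (OuterConnected H D)
  outerConnected? D with all? (λ u → all? (λ v → outside? u →-dec (outside? v →-dec walk? outside? inside u v)) vs) vs
    where
    outside? : Decidable (λ x → InV H x × x ∉ D)
    outside? x = InV? x ×-dec ¬? (x ∈? D)
    inside : ∀ {x} → InV H x × x ∉ D → x ∈ vs
    inside (ix , _) = vs-complete ix
  ... | yes all = yes (λ u v iu u∉D iv v∉D → All.lookup (All.lookup all (vs-complete iu)) (vs-complete iv) (iu , u∉D) (iv , v∉D))
  ... | no ¬all = no (λ oc → ¬all (All.tabulate (λ {u} _ → All.tabulate (λ {v} _ (iu , u∉D) (iv , v∉D) → oc u v iu u∉D iv v∉D))))

  TOCDS? : ∀ D → Dec (TOCDS H D)
  TOCDS? D = (unique? _≟_ D ×-dec (all? InV? D ×-dec dominates? D)) ×-dec outerConnected? D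

  γtc-exists : ∀ D₀ → TOCDS H D₀ → ∃[ k ] (γtc H k × k ≤ length D₀)
  γtc-exists D₀ tocds₀ =
    length D* , ((D* , Extrema.argmin-all length tocds₀ (all-filter TOCDS? shortLists) , refl) , minimal) ,
    Extrema.f[argmin]≤f[⊤] {f = length} D₀ candidates
    where
    shortLists candidates : List (List C)
    shortLists = boundedLists (length vs) vs
    candidates = filter TOCDS? shortLists
    D* : List C
    D* = Extrema.argmin length D₀ candidates
    candidate : ∀ D → TOCDS H D → D ∈ candidates
    candidate D tocds@((D! , D⊆V , _) , _) =
      ∈-filter⁺ TOCDS? (∈-boundedLists (All.map vs-complete D⊆V)
                                       (Unique⇒length≤ _≟_ vs D! (λ x∈D → vs-complete (All.lookup D⊆V x∈D)))) tocds
    minimal : ∀ D → TOCDS H D → length D* ≤ length D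
    minimal D tocds = All.lookup (Extrema.f[argmin]≤f[xs] {f = length} D₀ candidates) (candidate D tocds)

private
  from-zero : ∀ {n} → Fin n → Fin (suc n) × Fin (suc n)
  from-zero j = fzero , fsuc j

  shift : ∀ {n} → Fin n × Fin n → Fin (suc n) × Fin (suc n)
  shift (i , j) = fsuc i , fsuc j

pairs : ∀ n → List (Fin n × Fin n)
pairs zero    = []
pairs (suc n) = tabulate from-zero ++ map shift (pairs n)

pairs-complete : ∀ {n} {i j : Fin n} → toℕ i < toℕ j → (i , j) ∈ pairs n
pairs-complete {suc n} {fzero} {fsuc j} _         = ∈-++⁺ˡ (∈-tabulate⁺ j)
pairs-complete {suc n} {fsuc i} {fsuc j} (s≤s i<j) =
  ∈-++⁺ʳ (tabulate from-zero) (∈-map⁺ shift (pairs-complete i<j))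

pairs-unique : ∀ n → Unique (pairs n)
pairs-unique zero    = []
pairs-unique (suc n) =
  Unique.++⁺ (Unique.tabulate⁺ (λ { refl → refl }))
             (Unique.map⁺ (λ { refl → refl }) (pairs-unique n))
             λ (p∈₀ , p∈₁) → case ∈-tabulate⁻ p∈₀ , ∈-map⁻ shift p∈₁ of
               λ { ((_ , refl) , (_ , _ , ())) }

length-pairs : ∀ n → 2 * length (pairs n) + n ≡ n * n
length-pairs zero    = refl
length-pairs (suc n) = begin
  2 * length (pairs (suc n)) + suc n      ≡⟨ cong (λ p → 2 * p + suc n) length-split ⟩
  2 * (n + length (pairs n)) + suc n      ≡⟨ regroup n (length (pairs n)) ⟩
  (2 * length (pairs n) + n) + 2 * n + 1  ≡⟨ cong (λ s → s + 2 * n + 1) (length-pairs n) ⟩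
  n * n + 2 * n + 1                       ≡⟨ square-suc n ⟩
  suc n * suc n                           ∎
  where
  open ≡-Reasoning
  length-split : length (pairs (suc n)) ≡ n + length (pairs n)
  length-split = trans (length-++ (tabulate {n = n} from-zero))
                       (cong₂ _+_ (length-tabulate {n = n} from-zero) (length-map shift (pairs n)))
  regroup : ∀ n p → 2 * (n + p) + suc n ≡ (2 * p + n) + 2 * n + 1
  regroup = solve-∀
  square-suc : ∀ n → n * n + 2 * n + 1 ≡ suc n * suc n
  square-suc = solve-∀

module _ {n : ℕ} where

  _≟ᴹ_ : DecidableEquality (MV n)
  vtx a ≟ᴹ vtx b with a ≟ᶠ b
  ... | yes refl = yes refl
  ... | no a≢b   = no (λ { refl → a≢b refl })
  vtx _ ≟ᴹ edg _ _ = no (λ ())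
  edg _ _ ≟ᴹ vtx _ = no (λ ())
  edg i j ≟ᴹ edg k l with i ≟ᶠ k | j ≟ᶠ l
  ... | yes refl | yes refl = yes refl
  ... | no i≢k   | _        = no (λ { refl → i≢k refl })
  ... | _        | no j≢l   = no (λ { refl → j≢l refl })

  middleVertices : List (MV n)
  middleVertices = map vtx (allFin n) ++ map (uncurry edg) (pairs n)

module _ {n : ℕ} (G : Graph n) where

  IsEdge? : ∀ i j → Dec (IsEdge G i j)
  IsEdge? i j = (toℕ i <? toℕ j) ×-dec T? (adj G i j)

  MInV? : Decidable (MInV G)
  MInV? (vtx _)   = yes tt
  MInV? (edg i j) = IsEdge? i j

  MAdj? : ∀ x y → Dec (MAdj G x y)
  MAdj? (vtx _)   (vtx _)   = no (λ ())
  MAdj? (vtx a)   (edg i j) = IsEdge? i j ×-dec ((a ≟ᶠ i) ⊎-dec (a ≟ᶠ j))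
  MAdj? (edg i j) (vtx a)   = IsEdge? i j ×-dec ((a ≟ᶠ i) ⊎-dec (a ≟ᶠ j))
  MAdj? (edg i j) (edg k l) =
    IsEdge? i j ×-dec (IsEdge? k l ×-dec (¬? (edg i j ≟ᴹ edg k l) ×-dec
      ((i ≟ᶠ k) ⊎-dec ((i ≟ᶠ l) ⊎-dec ((j ≟ᶠ k) ⊎-dec (j ≟ᶠ l))))))

  middleVertices-complete : ∀ {x} → MInV G x → x ∈ middleVertices
  middleVertices-complete {vtx a}   _          = ∈-++⁺ˡ (∈-map⁺ vtx (∈-allFin a))
  middleVertices-complete {edg i j} (i<j , _) =
    ∈-++⁺ʳ (map vtx (allFin n)) (∈-map⁺ (uncurry edg) (pairs-complete i<j))

  γtc-Middle-exists : ∀ D₀ → TOCDS (Middle G) D₀ → ∃[ k ] (γtc (Middle G) k × k ≤ length D₀)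
  γtc-Middle-exists =
    FiniteSearch.γtc-exists _≟ᴹ_ (Middle G) MInV? MAdj? middleVertices middleVertices-complete

distinct-from-two : ∀ {n} → 3 ≤ n → (v w : Fin n) → ∃[ c ] (c ≢ v × c ≢ w)
distinct-from-two (s≤s (s≤s (s≤s _))) fzero        fzero        = fsuc fzero , (λ ()) , (λ ())
distinct-from-two (s≤s (s≤s (s≤s _))) fzero        (fsuc fzero) = fsuc (fsuc fzero) , (λ ()) , (λ ())
distinct-from-two (s≤s (s≤s (s≤s _))) fzero        (fsuc (fsuc _)) = fsuc fzero , (λ ()) , (λ ())
distinct-from-two (s≤s (s≤s (s≤s _))) (fsuc fzero) fzero        = fsuc (fsuc fzero) , (λ ()) , (λ ())
distinct-from-two (s≤s (s≤s (s≤s _))) (fsuc fzero) (fsuc _)     = fzero , (λ ()) , (λ ())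
distinct-from-two (s≤s (s≤s (s≤s _))) (fsuc (fsuc _)) fzero     = fsuc fzero , (λ ()) , (λ ())
distinct-from-two (s≤s (s≤s (s≤s _))) (fsuc (fsuc _)) (fsuc _)  = fzero , (λ ()) , (λ ())

other-vertex : ∀ {n} → 2 ≤ n → (a : Fin n) → ∃[ c ] c ≢ a
other-vertex (s≤s (s≤s _)) a = punchIn a fzero , punchInᵢ≢i a fzero

adj-compl-disjoint : ∀ {n} (G : Graph n) i j → T (adj G i j) → T (adj (compl G) i j) → ⊥
adj-compl-disjoint G i j ij ij̄ with adj G i j
... | true = ij̄

module _ {n : ℕ} (G : Graph n) where

  adj-sym-T : ∀ {a b} → T (adj G a b) → T (adj G b a)
  adj-sym-T {a} {b} = subst T (adj-sym G a b)

  adj⇒≢ : ∀ {a b} → T (adj G a b) → a ≢ b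
  adj⇒≢ {a} ab refl = subst T (adj-irrefl G a) ab

  connected⇒neighbour : 2 ≤ n → Connected G → ∀ a → ∃[ b ] T (adj G a b)
  connected⇒neighbour 2≤n connected a with other-vertex 2≤n a
  ... | c , c≢a with connected a c
  ...   | here _              = ⊥-elim (c≢a refl)
  ...   | step {w = b} _ ab _ = b , ab

  edgeBetween : Fin n → Fin n → MV n
  edgeBetween a b with toℕ a <? toℕ b
  ... | yes _ = edg a b
  ... | no _  = edg b a

  edgeBetween-< : ∀ {a b} → toℕ a < toℕ b → edgeBetween a b ≡ edg a b
  edgeBetween-< {a} {b} a<b with toℕ a <? toℕ b
  ... | yes _   = refl
  ... | no a≮b  = ⊥-elim (a≮b a<b)

  edgeBetween-> : ∀ {a b} → toℕ b < toℕ a → edgeBetween a b ≡ edg b a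
  edgeBetween-> {a} {b} b<a with toℕ a <? toℕ b
  ... | yes a<b = ⊥-elim (<-asym a<b b<a)
  ... | no _    = refl

  edgeBetween≢vtx : ∀ a b c → edgeBetween a b ≢ vtx c
  edgeBetween≢vtx a b c with toℕ a <? toℕ b
  ... | yes _ = λ ()
  ... | no _  = λ ()

  adj⇒MAdj-edgeBetween : ∀ {a b} → T (adj G a b) → MAdj G (vtx a) (edgeBetween a b)
  adj⇒MAdj-edgeBetween {a} {b} ab with toℕ a <? toℕ b
  ... | yes a<b = (a<b , ab) , inj₁ refl
  ... | no a≮b  = (b<a , adj-sym-T ab) , inj₂ refl
    where
    b<a : toℕ b < toℕ a
    b<a = ≤∧≢⇒< (≮⇒≥ a≮b) (λ b≡a → adj⇒≢ ab (sym (toℕ-injective b≡a)))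

  MAdj-vtx⇒edgeBetween : ∀ {a x} → MAdj G (vtx a) x → ∃[ b ] (T (adj G a b) × x ≡ edgeBetween a b)
  MAdj-vtx⇒edgeBetween {x = edg i j} ((i<j , ij) , inj₁ refl) = j , ij , sym (edgeBetween-< i<j)
  MAdj-vtx⇒edgeBetween {x = edg i j} ((i<j , ij) , inj₂ refl) = i , adj-sym-T ij , sym (edgeBetween-> i<j)

  MAdj-vtx⇒MInV : ∀ {a x} → MAdj G (vtx a) x → MInV G x
  MAdj-vtx⇒MInV {x = edg i j} (ij , _) = ij

  common-MAdj⇒adj : ∀ {v w x} → MAdj G (vtx v) x → MAdj G (vtx w) x → v ≢ w → T (adj G v w)
  common-MAdj⇒adj {x = edg i j} (_ , inj₁ refl)        (_ , inj₁ refl) v≢w = ⊥-elim (v≢w refl)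
  common-MAdj⇒adj {x = edg i j} ((_ , ij) , inj₁ refl) (_ , inj₂ refl) _   = ij
  common-MAdj⇒adj {x = edg i j} ((_ , ij) , inj₂ refl) (_ , inj₁ refl) _   = adj-sym-T ij
  common-MAdj⇒adj {x = edg i j} (_ , inj₂ refl)        (_ , inj₂ refl) v≢w = ⊥-elim (v≢w refl)

module Leaves {n : ℕ} (G : Graph n) where

  neighbours : Fin n → List (Fin n)
  neighbours v = filter (λ w → T? (adj G v w)) (allFin n)

  -- Meaningful only for leaves; an isolated vertex is returned unchanged.
  neighbour : Fin n → Fin n
  neighbour v with neighbours v
  ... | []    = v
  ... | u ∷ _ = u

  leaf-neighbour : ∀ {v} → deg G v ≡ 1 → T (adj G v (neighbour v)) × (∀ w → T (adj G v w) → w ≡ neighbour v)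
  leaf-neighbour {v} deg≡1 with neighbours v in eq
  ... | u ∷ [] = proj₂ (∈-filter⁻ (λ w → T? (adj G v w)) {xs = allFin n} (subst (u ∈_) (sym eq) (here refl))) ,
                 λ w vw → only (subst (w ∈_) eq (∈-filter⁺ (λ w → T? (adj G v w)) (∈-allFin w) vw))
    where
    only : ∀ {w} → w ∈ u ∷ [] → w ≡ u
    only (here w≡u) = w≡u

  leafEdge : Fin n → MV n
  leafEdge v = edgeBetween G v (neighbour v)

  leaf⇒deg≡1 : ∀ {v} → v ∈ leaf G → deg G v ≡ 1
  leaf⇒deg≡1 v∈ = proj₂ (∈-filter⁻ _ {xs = allFin n} v∈)

  leaf-unique : Unique (leaf G)
  leaf-unique = Unique.filter⁺ _ (Unique.allFin⁺ n)

  MAdj-leafEdge : ∀ {v} → deg G v ≡ 1 → MAdj G (vtx v) (leafEdge v)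
  MAdj-leafEdge deg≡1 = adj⇒MAdj-edgeBetween G (proj₁ (leaf-neighbour deg≡1))

  MAdj-leaf⇒leafEdge : ∀ {v x} → deg G v ≡ 1 → MAdj G (vtx v) x → x ≡ leafEdge v
  MAdj-leaf⇒leafEdge {v} deg≡1 vx with MAdj-vtx⇒edgeBetween G vx
  ... | b , vb , refl = cong (edgeBetween G v) (proj₂ (leaf-neighbour deg≡1) b vb)

  walk-from-leaf-edge : ∀ {v w} → deg G v ≡ 1 → deg G w ≡ 1 → T (adj G v w) →
                        ∀ {x c} → x ≡ v ⊎ x ≡ w → Walk (asGr G) (λ _ → ⊤) x c → c ≡ v ⊎ c ≡ w
  walk-from-leaf-edge _ _ _ x∈vw (here _) = x∈vw
  walk-from-leaf-edge {v} {w} dv dw vw (inj₁ refl) (step {w = y} _ vy yc) =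
    walk-from-leaf-edge dv dw vw (inj₂ (trans (proj₂ (leaf-neighbour dv) y vy) (sym (proj₂ (leaf-neighbour dv) w vw)))) yc
  walk-from-leaf-edge {v} {w} dv dw vw (inj₂ refl) (step {w = y} _ wy yc) =
    walk-from-leaf-edge dv dw vw (inj₁ (trans (proj₂ (leaf-neighbour dw) y wy) (sym (proj₂ (leaf-neighbour dw) v (adj-sym-T G vw))))) yc

  module _ (3≤n : 3 ≤ n) (connected : Connected G) where

    leaves-nonadjacent : ∀ {v w} → deg G v ≡ 1 → deg G w ≡ 1 → ¬ T (adj G v w)
    leaves-nonadjacent {v} {w} dv dw vw with distinct-from-two 3≤n v w
    ... | c , c≢v , c≢w with walk-from-leaf-edge dv dw vw (inj₁ refl) (connected v c)
    ...   | inj₁ c≡v = c≢v c≡v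
    ...   | inj₂ c≡w = c≢w c≡w

    leafEdge-injective : ∀ {v w} → v ∈ leaf G → w ∈ leaf G → leafEdge v ≡ leafEdge w → v ≡ w
    leafEdge-injective {v} {w} v∈ w∈ same with v ≟ᶠ w
    ... | yes v≡w = v≡w
    ... | no v≢w  = ⊥-elim (leaves-nonadjacent (leaf⇒deg≡1 v∈) (leaf⇒deg≡1 w∈)
                      (common-MAdj⇒adj G (subst (MAdj G (vtx v)) same (MAdj-leafEdge (leaf⇒deg≡1 v∈)))
                                         (MAdj-leafEdge (leaf⇒deg≡1 w∈)) v≢w))

    length-leaf< : ∀ {v} → v ∈ leaf G → length (leaf G) < n
    length-leaf< {v} v∈ =
      subst (suc (length (leaf G)) ≤_) (length-tabulate (λ i → i))
            (Unique⇒length≤ _≟ᶠ_ (allFin n) (neighbour∉leaf ∷ leaf-unique) (λ _ → ∈-allFin _))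
      where
      neighbour∉leaf : All (neighbour v ≢_) (leaf G)
      neighbour∉leaf = All.tabulate (λ w∈ u≡w → leaves-nonadjacent (leaf⇒deg≡1 v∈) (leaf⇒deg≡1 w∈)
                         (subst (T ∘ adj G v) u≡w (proj₁ (leaf-neighbour (leaf⇒deg≡1 v∈)))))

    module _ {D : List (MV n)} (tocds : TOCDS (Middle G) D) where

      open import Data.List.Membership.DecPropositional (_≟ᴹ_ {n}) using (_∈?_)

      leafEdge∈D : ∀ {v} → v ∈ leaf G → leafEdge v ∈ D
      leafEdge∈D {v} v∈ with proj₂ (proj₂ (proj₁ tocds)) (vtx v) tt
      ... | x , x∈D , vx = subst (_∈ D) (MAdj-leaf⇒leafEdge (leaf⇒deg≡1 v∈) vx) x∈D

      -- Outside D, vtx v is isolated: its only neighbour in M(G) is leafEdge v ∈ D.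
      vertices∈D : ∀ {v} → v ∈ leaf G → vtx v ∉ D → ∀ c → c ≢ v → vtx c ∈ D
      vertices∈D {v} v∈ v∉D c c≢v with vtx c ∈? D
      ... | yes c∈D = c∈D
      ... | no c∉D with proj₂ tocds (vtx v) (vtx c) tt v∉D tt c∉D
      ...   | here _              = ⊥-elim (c≢v refl)
      ...   | step {w = x} _ vx xc =
        ⊥-elim (proj₂ (Walk-head xc) (subst (_∈ D) (sym (MAdj-leaf⇒leafEdge (leaf⇒deg≡1 v∈) vx)) (leafEdge∈D v∈)))

      leafEdges+vertices≤ : ∀ ws → Unique ws → (∀ {w} → w ∈ ws → vtx w ∈ D) → length (leaf G) + length ws ≤ length D
      leafEdges+vertices≤ ws ws! ws⊆D =
        subst (_≤ length D) length-both (Unique⇒length≤ _≟ᴹ_ D both! both⊆D)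
        where
        both : List (MV n)
        both = map leafEdge (leaf G) ++ map vtx ws
        both! : Unique both
        both! = Unique.++⁺ (Unique-map⁺ leaf-unique leafEdge-injective)
                           (Unique.map⁺ (λ { refl → refl }) ws!)
                           λ (x∈₀ , x∈₁) → case ∈-map⁻ leafEdge x∈₀ , ∈-map⁻ vtx x∈₁ of λ where
                             ((v , _ , refl) , (w , _ , x≡vtx)) → edgeBetween≢vtx G v (neighbour v) w x≡vtx
        both⊆D : ∀ {x} → x ∈ both → x ∈ D
        both⊆D x∈ with ∈-++⁻ (map leafEdge (leaf G)) x∈
        ... | inj₁ x∈₀ = let (v , v∈ , x≡) = ∈-map⁻ leafEdge x∈₀ in subst (_∈ D) (sym x≡) (leafEdge∈D v∈)
        ... | inj₂ x∈₁ = let (w , w∈ , x≡) = ∈-map⁻ vtx x∈₁ in subst (_∈ D) (sym x≡) (ws⊆D w∈)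
        length-both : length both ≡ length (leaf G) + length ws
        length-both = trans (length-++ (map leafEdge (leaf G))) (cong₂ _+_ (length-map leafEdge (leaf G)) (length-map vtx ws))

      twice-leaves≤ : 2 * length (leaf G) ≤ length D
      twice-leaves≤ with all? (λ v → vtx v ∈? D) (leaf G)
      ... | yes all-in = subst (λ k → length (leaf G) + k ≤ length D) (sym (+-identityʳ _))
                           (leafEdges+vertices≤ (leaf G) leaf-unique (All.lookup all-in))
      ... | no ¬all-in with find (¬All⇒Any¬ (λ v → vtx v ∈? D) (leaf G) ¬all-in)
      ...   | v , v∈ , v∉D =
        ≤-trans (+-monoʳ-≤ (length (leaf G)) (subst (_≤ length others) (sym (+-identityʳ _)) leaves≤others))
                (leafEdges+vertices≤ others (Unique.filter⁺ ≢v? (Unique.allFin⁺ n)) others⊆D)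
        where
        ≢v? : Decidable (_≢ v)
        ≢v? c = ¬? (c ≟ᶠ v)
        others : List (Fin n)
        others = filter ≢v? (allFin n)
        others⊆D : ∀ {c} → c ∈ others → vtx c ∈ D
        others⊆D c∈ = vertices∈D v∈ v∉D _ (proj₂ (∈-filter⁻ ≢v? {xs = allFin n} c∈))
        n≤1+others : n ≤ suc (length others)
        n≤1+others = subst (_≤ suc (length others)) (length-tabulate (λ i → i))
          (Unique⇒length≤ _≟ᶠ_ (v ∷ others) (Unique.allFin⁺ n) λ {c} _ → case c ≟ᶠ v of λ where
            (yes c≡v) → here c≡v
            (no c≢v)  → there (∈-filter⁺ ≢v? (∈-allFin c) c≢v))
        leaves≤others : length (leaf G) ≤ length others
        leaves≤others = ≤-pred (≤-trans (length-leaf< v∈) n≤1+others)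

γtc-Middle-lower : ∀ {n} (G : Graph n) {k} → 3 ≤ n → Connected G → γtc (Middle G) k → 2 * length (leaf G) ≤ k
γtc-Middle-lower G 3≤n connected ((_ , tocds , refl) , _) = Leaves.twice-leaves≤ G 3≤n connected tocds

edgeList : ∀ {n} → Graph n → List (Fin n × Fin n)
edgeList {n} G = filter (uncurry (IsEdge? G)) (pairs n)

edgeList-compl : ∀ {n} (G : Graph n) → length (edgeList G) + length (edgeList (compl G)) ≤ length (pairs n)
edgeList-compl {n} G = length-filter-disjoint (uncurry (IsEdge? G)) (uncurry (IsEdge? (compl G)))
  (λ (i , j) (_ , ij) (_ , ij̄) → adj-compl-disjoint G i j ij ij̄) (pairs n)

module _ {m : ℕ} (G : Graph (suc m)) where

  allButZero : List (MV (suc m))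
  allButZero = map (vtx ∘ fsuc) (allFin m) ++ map (uncurry edg) (edgeList G)

  ∈-allButZero : ∀ {x} → MInV G x → x ≢ vtx fzero → x ∈ allButZero
  ∈-allButZero {vtx fzero}    _ x≢0 = ⊥-elim (x≢0 refl)
  ∈-allButZero {vtx (fsuc a)} _ _   = ∈-++⁺ˡ (∈-map⁺ (vtx ∘ fsuc) (∈-allFin a))
  ∈-allButZero {edg i j}      ij _  =
    ∈-++⁺ʳ (map (vtx ∘ fsuc) (allFin m)) (∈-map⁺ (uncurry edg) (∈-filter⁺ (uncurry (IsEdge? G)) (pairs-complete (proj₁ ij)) ij))

  length-allButZero : length allButZero ≡ m + length (edgeList G)
  length-allButZero = trans (length-++ (map (vtx ∘ fsuc) (allFin m)))
    (cong₂ _+_ (trans (length-map (vtx ∘ fsuc) (allFin m)) (length-tabulate (λ i → i))) (length-map (uncurry edg) (edgeList G)))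

  allButZero-TOCDS : 2 ≤ suc m → Connected G → TOCDS (Middle G) allButZero
  allButZero-TOCDS 2≤n connected = (unique , inV , dominated) , outerConnected
    where
    unique : Unique allButZero
    unique = Unique.++⁺ (Unique.map⁺ (λ { refl → refl }) (Unique.allFin⁺ m))
                        (Unique.map⁺ (λ { refl → refl }) (Unique.filter⁺ _ (pairs-unique (suc m))))
                        λ (x∈₀ , x∈₁) → case ∈-map⁻ (vtx ∘ fsuc) x∈₀ , ∈-map⁻ (uncurry edg) x∈₁ of λ where
                          ((_ , _ , refl) , (_ , _ , ()))
    inV : All (MInV G) allButZero
    inV = All-++⁺ (All-map⁺ (All.tabulate (λ _ → tt))) (All-map⁺ (all-filter (uncurry (IsEdge? G)) (pairs (suc m))))
    dominated : ∀ x → MInV G x → ∃[ y ] (y ∈ allButZero × MAdj G x y)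
    dominated (vtx a) _ with connected⇒neighbour G 2≤n connected a
    ... | b , ab = edgeBetween G a b , ∈-allButZero (MAdj-vtx⇒MInV G ax) (edgeBetween≢vtx G a b fzero) , ax
      where ax = adj⇒MAdj-edgeBetween G ab
    dominated (edg i j) (i<j , ij) = vtx j , ∈-allButZero tt (λ { refl → n≮0 i<j }) , ((i<j , ij) , inj₂ refl)
    outerConnected : OuterConnected (Middle G) allButZero
    outerConnected u v iu u∉ iv v∉ with u ≟ᴹ vtx fzero | v ≟ᴹ vtx fzero
    ... | yes refl | yes refl = here (iu , u∉)
    ... | no u≢0   | _        = ⊥-elim (u∉ (∈-allButZero iu u≢0))
    ... | _        | no v≢0   = ⊥-elim (v∉ (∈-allButZero iv v≢0))

  γtc-Middle-upper : 2 ≤ suc m → Connected G → ∃[ k ] (γtc (Middle G) k × k ≤ m + length (edgeList G))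
  γtc-Middle-upper 2≤n connected with γtc-Middle-exists G allButZero (allButZero-TOCDS 2≤n connected)
  ... | k , γ , k≤ = k , γ , subst (k ≤_) length-allButZero k≤

n²+3n∸4≡ : ∀ m p → 2 * p + suc m ≡ suc m * suc m → suc m * suc m + 3 * suc m ∸ 4 ≡ 2 * (2 * m + p)
n²+3n∸4≡ m p pairs-count = begin
  suc m * suc m + 3 * suc m ∸ 4    ≡⟨ cong (λ s → s + 3 * suc m ∸ 4) (sym pairs-count) ⟩
  (2 * p + suc m) + 3 * suc m ∸ 4  ≡⟨ cong (_∸ 4) (regroup m p) ⟩
  2 * (2 * m + p) + 4 ∸ 4          ≡⟨ m+n∸n≡m _ 4 ⟩
  2 * (2 * m + p)                  ∎
  where
  open ≡-Reasoning
  regroup : ∀ m p → (2 * p + suc m) + 3 * suc m ≡ 2 * (2 * m + p) + 4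
  regroup = solve-∀

complementary-upper-bound : ∀ {m} (G : Graph (suc m)) {k₁ k₂} →
                            k₁ ≤ m + length (edgeList G) → k₂ ≤ m + length (edgeList (compl G)) →
                            2 * (k₁ + k₂) ≤ suc m * suc m + 3 * suc m ∸ 4
complementary-upper-bound {m} G {k₁} {k₂} k₁≤ k₂≤ = begin
  2 * (k₁ + k₂)            ≤⟨ *-monoʳ-≤ 2 (+-mono-≤ k₁≤ k₂≤) ⟩
  2 * ((m + a) + (m + b))  ≡⟨ cong (2 *_) (interchange m a b) ⟩
  2 * (2 * m + (a + b))    ≤⟨ *-monoʳ-≤ 2 (+-monoʳ-≤ (2 * m) (edgeList-compl G)) ⟩
  2 * (2 * m + p)          ≡⟨ n²+3n∸4≡ m p (length-pairs (suc m)) ⟨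
  suc m * suc m + 3 * suc m ∸ 4 ∎
  where
  open ≤-Reasoning
  a b p : ℕ
  a = length (edgeList G)
  b = length (edgeList (compl G))
  p = length (pairs (suc m))
  interchange : ∀ m a b → (m + a) + (m + b) ≡ 2 * m + (a + b)
  interchange = solve-∀

theorem5p2 : ∀ (n : ℕ) (G : Graph n) → 4 ≤ n → Connected G → Connected (compl G) →
    ∃[ k₁ ] ∃[ k₂ ] (γtc (Middle G) k₁ × γtc (Middle (compl G)) k₂ ×
      2 * length (leaf G) + 2 * length (leaf (compl G)) ≤ k₁ + k₂ ×
      2 * (k₁ + k₂) ≤ n * n + 3 * n ∸ 4)
theorem5p2 (suc m) G 4≤n connected connected̄
  with γtc-Middle-upper G 2≤n connected | γtc-Middle-upper (compl G) 2≤n connected̄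
  where
  2≤n : 2 ≤ suc m
  2≤n = ≤-trans (s≤s (s≤s z≤n)) 4≤n
... | k₁ , γ₁ , k₁≤ | k₂ , γ₂ , k₂≤ =
  k₁ , k₂ , γ₁ , γ₂ ,
  +-mono-≤ (γtc-Middle-lower G 3≤n connected γ₁) (γtc-Middle-lower (compl G) 3≤n connected̄ γ₂) ,
  complementary-upper-bound G k₁≤ k₂≤
  where
  3≤n : 3 ≤ suc m
  3≤n = ≤-trans (n≤1+n 3) 4≤n
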